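{- Let $n$ be an integer with $n \geq 11$. If $n \equiv 2,5,8 \pmod{11}$, then $\lceil 4n/11 \rceil \leq \gamma^{ID}(C_n(1,3)) \leq \lceil 4n/11 \rceil + 1$; otherwise $\gamma^{ID}(C_n(1,3)) = \lceil 4n/11 \rceil$.
   Context: For a positive integer $n$, the circulant graph $C_n(1,3)$ has vertex set $\mathbb{Z}_n=\{0,1,\dots,n-1\}$, and the open neighbourhood of $u$ is $N(u)=\{u\pm 1, u\pm 3\}$ (computed modulo $n$); the closed neighbourhood is $N[u]=N(u)\cup\{u\}$. A code is a nonempty subset $C\subseteq \mathbb{Z}_n$; for a vertex $u$, its identifying set is $I(C;u)=N[u]\cap C$. The code $C$ is identifying if $I(C;u)\neq\emptyset$ for all vertices $u$ and $I(C;u)\neq I(C;v)$ for all distinct vertices $u,v$. $\gamma^{ID}(G)$ denotes the minimum cardinality of an identifying code in $G$. -}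

module Defs where

open import Data.Nat using (ℕ; zero; suc; _+_; _*_; _∸_; _≤_; NonZero)
open import Data.Nat.DivMod using (_%_; _/_)
open import Data.Fin using (Fin; toℕ)
open import Data.Fin.Subset using (Subset; _∈_; ∣_∣)
open import Data.Product using (Σ; _×_; ∃)
open import Data.Sum using (_⊎_)
open import Relation.Binary.PropositionalEquality using (_≡_)
open import Relation.Nullary using (¬_)
open import Function.Bundles using (_⇔_)

-- Subtraction of d ∈ {1,3} is computed as (u + 3n - d) mod n, which is
-- correct for every n ≥ 1.
InClosedNbhd : (n : ℕ) → .{{_ : NonZero n}} → Fin n → Fin n → Set
InClosedNbhd n u v =
  (toℕ v ≡ toℕ u % n)
  ⊎ (toℕ v ≡ (toℕ u + 1) % n)
  ⊎ (toℕ v ≡ (toℕ u + 3 * n ∸ 1) % n)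
  ⊎ (toℕ v ≡ (toℕ u + 3) % n)
  ⊎ (toℕ v ≡ (toℕ u + 3 * n ∸ 3) % n)

IsIdentifying : (n : ℕ) → .{{_ : NonZero n}} → Subset n → Set
IsIdentifying n C =
  (∃ λ c → c ∈ C)
  × (∀ u → ∃ λ c → c ∈ C × InClosedNbhd n u c)
  × (∀ u v → ¬ (u ≡ v) →
       ¬ (∀ c → (c ∈ C × InClosedNbhd n u c) ⇔ (c ∈ C × InClosedNbhd n v c)))

IsGammaID : (n : ℕ) → .{{_ : NonZero n}} → ℕ → Set
IsGammaID n k =
  (Σ (Subset n) λ C → IsIdentifying n C × ∣ C ∣ ≡ k)
  × (∀ C → IsIdentifying n C → k ≤ ∣ C ∣)

ceil4n/11 : ℕ → ℕ
ceil4n/11 n = (4 * n + 10) / 11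

module Submission where

-- Write a code C ⊆ Z_n as a bit stream x_i (i mod n).  Since N[u] = u + {-3,-1,0,1,3},
-- everything is decided by 13-bit windows x_p … x_{p+12}: the window is locally
-- valid when each of its centres p+3, …, p+9 has a codeword in its closed
-- neighbourhood (which lies inside the window) and every two of them are
-- separated by a codeword of the window.
--
-- Every window of an identifying code is locally valid.  A
-- potential φ on 10-bit strings satisfies 4 + φ(x_p…) ≤ 11 x_p + φ(x_{p+1}…) on all
-- locally valid windows (checked exhaustively); summing around the cycle gives
-- 4n ≤ 11|C|, i.e. |C| ≥ ⌈4n/11⌉.  Conversely, for n ≥ 13 a code whose windows are all locally valid
-- is identifying.  Explicit words P^k B_r (P = 11001100000, |B_r| = 11 + r) give
-- such codes of size ⌈4n/11⌉ + excess r, where excess r = 1 iff r ∈ {2,5,8} and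
-- r = n mod 11; n = 11, 12 are checked by a decision procedure.  Being identifying is decidable, so either a code of size ⌈4n/11⌉
-- exists (and is optimal), or the constructed code of size ⌈4n/11⌉ + 1 is optimal,
-- which can only happen for r ∈ {2,5,8}.

open import Defs
open import Data.Nat using (ℕ; NonZero; _+_; _*_; _≤_; _%_)
open import Data.Bool using (T)
open import Data.Fin.Subset using (Subset; ∣_∣)
open import Data.Product using (Σ; _×_; _,_)
open import Data.Sum using (_⊎_; inj₁; inj₂)
open import Relation.Binary.PropositionalEquality using (_≡_; refl)
open import Relation.Nullary using (¬_)


module Residues (n : ℕ) .{{_ : NonZero n}} where
  open import Data.Nat
  open import Data.Nat.Properties
  open import Data.Nat.DivMod
  open import Data.Fin using (Fin; toℕ; fromℕ<)
  open import Data.Fin.Properties using (toℕ-fromℕ<; toℕ-injective; toℕ<n)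
  open import Data.Empty using (⊥-elim)
  open import Data.Sum using (inj₁; inj₂)
  open import Relation.Binary.PropositionalEquality
  open ≡-Reasoning

  %-absorbˡ : ∀ a k → (a % n + k) % n ≡ (a + k) % n
  %-absorbˡ a k = begin
    (a % n + k) % n          ≡⟨ %-distribˡ-+ (a % n) k n ⟩
    (a % n % n + k % n) % n  ≡⟨ cong (λ r → (r + k % n) % n) (m%n%n≡m%n a n) ⟩
    (a % n + k % n) % n      ≡⟨ sym (%-distribˡ-+ a k n) ⟩
    (a + k) % n              ∎

  -- A shift t < n preserving the residue of a is zero: comparing quotients,
  -- t = (q₂ ∸ q₁) · n, and the only multiple of n below n is 0.
  shift-zero : ∀ a t → (a + t) % n ≡ a % n → t < n → t ≡ 0
  shift-zero a t same t<n = below-n (q₂ ∸ q₁) t≡multiple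
    where
    q₁ = a / n
    q₂ = (a + t) / n
    t≡multiple : t ≡ (q₂ ∸ q₁) * n
    t≡multiple = begin
      t                                        ≡⟨ sym (m+n∸m≡n a t) ⟩
      a + t ∸ a                                ≡⟨ cong₂ _∸_ (m≡m%n+[m/n]*n (a + t) n) (m≡m%n+[m/n]*n a n) ⟩
      (a + t) % n + q₂ * n ∸ (a % n + q₁ * n)  ≡⟨ cong (λ r → r + q₂ * n ∸ (a % n + q₁ * n)) same ⟩
      a % n + q₂ * n ∸ (a % n + q₁ * n)        ≡⟨ [m+n]∸[m+o]≡n∸o (a % n) (q₂ * n) (q₁ * n) ⟩
      q₂ * n ∸ q₁ * n                          ≡⟨ sym (*-distribʳ-∸ n q₂ q₁) ⟩
      (q₂ ∸ q₁) * n                            ∎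
    below-n : ∀ k → t ≡ k * n → t ≡ 0
    below-n zero    t≡0    = t≡0
    below-n (suc k) t≡kn+n = ⊥-elim (<⇒≱ t<n (subst (n ≤_) (sym t≡kn+n) (m≤m+n n (k * n))))

  residue-injective : ∀ {a b} → a % n ≡ b % n → a ≤ b → b < a + n → a ≡ b
  residue-injective {a} {b} same a≤b b<a+n = begin
    a            ≡⟨ sym (+-identityʳ a) ⟩
    a + 0        ≡⟨ cong (a +_) (sym gap≡0) ⟩
    a + (b ∸ a)  ≡⟨ m+[n∸m]≡n a≤b ⟩
    b            ∎
    where
    gap≡0 : b ∸ a ≡ 0
    gap≡0 = shift-zero a (b ∸ a) (trans (cong (_% n) (m+[n∸m]≡n a≤b)) (sym same))
              (subst (b ∸ a <_) (m+n∸m≡n a n) (∸-monoˡ-< b<a+n a≤b))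

  residue-injective′ : ∀ {a b} → a % n ≡ b % n → a < b + n → b < a + n → a ≡ b
  residue-injective′ {a} {b} same a<b+n b<a+n with ≤-total a b
  ... | inj₁ a≤b = residue-injective same a≤b b<a+n
  ... | inj₂ b≤a = sym (residue-injective (sym same) b≤a a<b+n)

  vertex : ℕ → Fin n
  vertex m = fromℕ< (m%n<n m n)

  toℕ-vertex : ∀ m → toℕ (vertex m) ≡ m % n
  toℕ-vertex m = toℕ-fromℕ< (m%n<n m n)

  vertex-unique : ∀ {c m} → toℕ c ≡ m % n → c ≡ vertex m
  vertex-unique {c} {m} c≡m = toℕ-injective (trans c≡m (sym (toℕ-vertex m)))

  named-by : ∀ (c : Fin n) {m} k → m ≡ toℕ c + k * n → toℕ c ≡ m % n
  named-by c k refl = sym (trans ([m+kn]%n≡m%n (toℕ c) k n) (m<n⇒m%n≡m (toℕ<n c)))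

  vertex-toℕ : ∀ c → vertex (toℕ c) ≡ c
  vertex-toℕ c = sym (vertex-unique (named-by c 0 (sym (+-identityʳ (toℕ c)))))


-- A window
-- x₀ … x₁₂ is seen as the indicator of a code around seven centres at
-- positions 3 … 9; the closed neighbourhood of the centre at position a + 3
-- occupies the positions a + {0, 2, 3, 4, 6}.
module Windows where
  open import Data.Nat
  open import Data.Nat.Properties
  open import Data.Bool using (Bool; false; T; _∧_)
  open import Data.Bool.Properties using (T-∧)
  open import Data.Bool.ListAction using (any; all)
  open import Data.List using (List; []; _∷_; map; filter; _++_; upTo)
  open import Data.List.Membership.Propositional using (_∈_; _∉_; find; lose)
  open import Data.List.Membership.Propositional.Properties
    using (∈-map⁺; ∈-map⁻; ∈-++⁺ˡ; ∈-++⁺ʳ; ∈-++⁻; ∈-filter⁺; ∈-filter⁻; ∈-upTo⁺; ∈-upTo⁻)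
  open import Data.List.Membership.DecPropositional _≟_ using (_∈?_)
  open import Data.List.Relation.Unary.Any using (here; there)
  open import Data.List.Relation.Unary.Any.Properties using (any⁺; any⁻)
  open import Data.Vec using (Vec; []; _∷_)
  open import Data.Product using (∃-syntax; _,_; proj₁; proj₂)
  open import Data.Sum using (inj₁; inj₂)
  open import Function using (_∘_; _⇔_; Equivalence)
  open import Relation.Nullary.Decidable using (¬?)
  open import Relation.Binary.PropositionalEquality

  window : (ℕ → Bool) → (m : ℕ) → Vec Bool m
  window f zero    = []
  window f (suc m) = f 0 ∷ window (f ∘ suc) m

  bit : ∀ {m} → Vec Bool m → ℕ → Bool
  bit []      _       = false
  bit (b ∷ w) zero    = b
  bit (b ∷ w) (suc q) = bit w q

  bit-window : ∀ f m q → q < m → bit (window f m) q ≡ f q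
  bit-window f (suc m) zero    _         = refl
  bit-window f (suc m) (suc q) (s≤s q<m) = bit-window (f ∘ suc) m q q<m

  window-cong : ∀ {f g} m → (∀ t → t < m → f t ≡ g t) → window f m ≡ window g m
  window-cong zero    f≗g = refl
  window-cong (suc m) f≗g = cong₂ _∷_ (f≗g 0 z<s) (window-cong m (λ t t<m → f≗g (suc t) (s<s t<m)))

  any-witness : ∀ {A : Set} (p : A → Bool) {xs} → T (any p xs) → ∃[ x ] x ∈ xs × T (p x)
  any-witness p {xs} = find ∘ any⁻ p xs

  any-intro : ∀ {A : Set} (p : A → Bool) {xs x} → x ∈ xs → T (p x) → T (any p xs)
  any-intro p x∈xs px = any⁺ p (lose x∈xs px)

  all-elim : ∀ {A : Set} (p : A → Bool) {xs x} → T (all p xs) → x ∈ xs → T (p x)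
  all-elim p {y ∷ xs} all-p (here refl)  = proj₁ (Equivalence.to T-∧ all-p)
  all-elim p {y ∷ xs} all-p (there x∈xs) = all-elim p (proj₂ (Equivalence.to T-∧ all-p)) x∈xs

  all-intro : ∀ {A : Set} (p : A → Bool) xs → (∀ {x} → x ∈ xs → T (p x)) → T (all p xs)
  all-intro p []       _     = _
  all-intro p (x ∷ xs) all-p = Equivalence.from T-∧ (all-p (here refl) , all-intro p xs (all-p ∘ there))

  -- Window offsets of the closed neighbourhood N[3] = {0, 2, 3, 4, 6}.
  offsets : List ℕ
  offsets = 0 ∷ 2 ∷ 3 ∷ 4 ∷ 6 ∷ []

  offset≤6 : ∀ {e} → e ∈ offsets → e ≤ 6
  offset≤6 (here refl)                                 = z≤n
  offset≤6 (there (here refl))                         = s≤s (s≤s z≤n)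
  offset≤6 (there (there (here refl)))                 = s≤s (s≤s (s≤s z≤n))
  offset≤6 (there (there (there (here refl))))         = s≤s (s≤s (s≤s (s≤s z≤n)))
  offset≤6 (there (there (there (there (here refl))))) = ≤-refl

  nbhd : ℕ → List ℕ
  nbhd a = map (a +_) offsets

  nbhd-range : ∀ {a q} → q ∈ nbhd a → a ≤ q × q ≤ a + 6
  nbhd-range {a} q∈ with ∈-map⁻ (a +_) q∈
  ... | e , e∈ , refl = m≤m+n a e , +-monoʳ-≤ a (offset≤6 e∈)

  separators : ℕ → ℕ → List ℕ
  separators a b = filter (λ q → ¬? (q ∈? nbhd b)) (nbhd a) ++ filter (λ q → ¬? (q ∈? nbhd a)) (nbhd b)

  separatorˡ : ∀ {a b q} → q ∈ nbhd a → q ∉ nbhd b → q ∈ separators a b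
  separatorˡ q∈a q∉b = ∈-++⁺ˡ (∈-filter⁺ (λ q → ¬? (q ∈? _)) q∈a q∉b)

  separatorʳ : ∀ {a b q} → q ∈ nbhd b → q ∉ nbhd a → q ∈ separators a b
  separatorʳ {a} {b} q∈b q∉a = ∈-++⁺ʳ (filter (λ q → ¬? (q ∈? nbhd b)) (nbhd a)) (∈-filter⁺ (λ q → ¬? (q ∈? _)) q∈b q∉a)

  separator⁻ : ∀ {a b q} → q ∈ separators a b → (q ∈ nbhd a × q ∉ nbhd b) ⊎ (q ∈ nbhd b × q ∉ nbhd a)
  separator⁻ {a} {b} q∈ with ∈-++⁻ (filter (λ q → ¬? (q ∈? nbhd b)) (nbhd a)) q∈
  ... | inj₁ q∈ˡ = inj₁ (∈-filter⁻ (λ q → ¬? (q ∈? _)) q∈ˡ)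
  ... | inj₂ q∈ʳ = inj₂ (∈-filter⁻ (λ q → ¬? (q ∈? _)) q∈ʳ)

  Window : Set
  Window = Vec Bool 13

  dominated : Window → ℕ → Bool
  dominated w a = any (bit w) (nbhd a)

  separated : Window → ℕ → ℕ → Bool
  separated w a b = any (bit w) (separators a b)

  allDominated allSeparated locallyValid : Window → Bool
  allDominated w = all (dominated w) (upTo 7)
  allSeparated w = all (λ b → all (λ a → separated w a b) (upTo b)) (upTo 7)
  locallyValid w = allDominated w ∧ allSeparated w

  private
    valid⇔ : ∀ {w} → T (locallyValid w) ⇔ (T (allDominated w) × T (allSeparated w))
    valid⇔ = T-∧

  valid⇒dominated : ∀ {w a} → T (locallyValid w) → a < 7 → T (dominated w a)
  valid⇒dominated {w} valid a<7 = all-elim (dominated w) (proj₁ (Equivalence.to (valid⇔ {w}) valid)) (∈-upTo⁺ a<7)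

  valid⇒separated : ∀ {w a b} → T (locallyValid w) → a < b → b < 7 → T (separated w a b)
  valid⇒separated {w} {a} {b} valid a<b b<7 =
    all-elim (λ a → separated w a b)
      (all-elim (λ b → all (λ a → separated w a b) (upTo b)) (proj₂ (Equivalence.to (valid⇔ {w}) valid)) (∈-upTo⁺ b<7))
      (∈-upTo⁺ a<b)

  valid-intro : ∀ w → (∀ a → a < 7 → T (dominated w a)) → (∀ a b → a < b → b < 7 → T (separated w a b)) →
                T (locallyValid w)
  valid-intro w dom sep = Equivalence.from (valid⇔ {w})
    ( all-intro (dominated w) (upTo 7) (λ a∈ → dom _ (∈-upTo⁻ a∈))
    , all-intro (λ b → all (λ a → separated w a b) (upTo b)) (upTo 7)
        (λ {b} b∈ → all-intro (λ a → separated w a b) (upTo b) (λ a∈ → sep _ b (∈-upTo⁻ a∈) (∈-upTo⁻ b∈))))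


-- The table was found by a computer search; it is checked here on all 2¹³
-- windows.  Summed around the cycle this gives 4n ≤ 11|C|.
module Potential where
  open import Data.Nat using (ℕ; zero; suc; _+_; _*_; _≤_; _≤ᵇ_)
  open import Data.Nat.Properties using (≤ᵇ⇒≤)
  open import Data.Bool using (Bool; true; false; T; _∧_; _∨_; not)
  open import Data.Bool.Properties using (T-∧; T-≡)
  open import Data.Vec using (Vec; []; _∷_; head; tail; take)
  open import Data.Product using (proj₁; proj₂)
  open import Function using (_∘_; Equivalence)
  open import Relation.Binary.PropositionalEquality using (_≡_; refl; cong)
  open Windows

  -- Binary tries of weights; a leaf gives the weight of every extension of its prefix.
  data Trie : Set where
    leaf : ℕ → Trie
    node : (ifFalse ifTrue : Trie) → Trie

  look : ∀ {m} → Trie → Vec Bool m → ℕ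
  look (leaf k)   _           = k
  look (node l r) []          = 0
  look (node l r) (false ∷ v) = look l v
  look (node l r) (true ∷ v)  = look r v

  table : Trie
  table =
    (node (node (node (node (node (node (leaf 0) (leaf 4)) (node (node (node (leaf 0) (node (leaf 0) (node
      (leaf 2) (leaf 7)))) (leaf 8)) (node (node (node (leaf 0) (node (leaf 5) (leaf 8))) (leaf 8)) (leaf
      8)))) (node (node (node (leaf 4) (node (node (leaf 5) (leaf 11)) (node (node (leaf 6) (leaf 11)) (leaf
      11)))) (node (node (node (leaf 7) (leaf 9)) (leaf 12)) (node (node (node (leaf 9) (leaf 12)) (leaf 12))
      (leaf 12)))) (node (node (node (leaf 0) (node (node (leaf 9) (leaf 12)) (leaf 12))) (leaf 12)) (node
      (node (node (node (leaf 9) (leaf 12)) (leaf 12)) (leaf 12)) (leaf 12))))) (node (node (node (node (leaf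
      7) (node (leaf 0) (node (leaf 0) (node (leaf 8) (leaf 11))))) (node (node (node (leaf 7) (leaf 9))
      (leaf 15)) (node (node (node (leaf 10) (leaf 12)) (leaf 15)) (leaf 15)))) (node (node (node (leaf 11)
      (node (leaf 0) (node (leaf 13) (leaf 16)))) (leaf 16)) (node (node (node (node (leaf 13) (leaf 16))
      (leaf 16)) (leaf 16)) (leaf 16)))) (node (node (node (node (node (leaf 10) (leaf 11)) (node (leaf 13)
      (leaf 15))) (node (node (leaf 13) (leaf 16)) (leaf 16))) (leaf 16)) (node (node (node (node (node (leaf
      13) (leaf 15)) (leaf 16)) (leaf 16)) (leaf 16)) (leaf 16))))) (node (node (node (node (leaf 11) (node
      (leaf 0) (node (leaf 15) (node (node (leaf 12) (leaf 15)) (leaf 15))))) (node (node (node (leaf 11)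
      (node (leaf 0) (node (leaf 13) (leaf 18)))) (leaf 19)) (node (node (node (node (leaf 14) (leaf 18))
      (node (leaf 16) (leaf 19))) (leaf 19)) (leaf 19)))) (node (node (node (node (leaf 14) (node (leaf 0)
      (node (leaf 18) (leaf 15)))) (node (node (leaf 16) (leaf 20)) (node (node (leaf 17) (leaf 20)) (leaf
      20)))) (node (node (node (node (leaf 17) (leaf 18)) (node (leaf 19) (leaf 20))) (leaf 20)) (leaf 20)))
      (node (node (node (node (node (leaf 17) (leaf 18)) (leaf 20)) (leaf 20)) (leaf 20)) (leaf 20)))) (node
      (node (node (node (node (leaf 14) (node (leaf 0) (node (leaf 15) (leaf 18)))) (node (node (leaf 0)
      (node (leaf 17) (leaf 19))) (node (leaf 0) (node (leaf 19) (leaf 20))))) (node (node (node (node (leaf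
      17) (leaf 18)) (node (leaf 17) (leaf 20))) (leaf 20)) (leaf 20))) (leaf 20)) (node (node (node (node
      (node (node (leaf 17) (leaf 20)) (node (leaf 19) (leaf 20))) (leaf 20)) (leaf 20)) (leaf 20)) (leaf
      20))))) (node (node (node (node (node (node (leaf 7) (leaf 11)) (node (node (leaf 9) (leaf 15)) (node
      (node (leaf 12) (leaf 15)) (leaf 15)))) (node (node (node (leaf 11) (node (node (leaf 12) (leaf 18))
      (node (leaf 13) (leaf 18)))) (node (node (node (leaf 14) (leaf 16)) (leaf 19)) (node (node (leaf 16)
      (leaf 19)) (leaf 19)))) (node (node (node (leaf 0) (node (leaf 16) (leaf 19))) (leaf 19)) (node (node
      (node (leaf 16) (leaf 19)) (leaf 19)) (leaf 19))))) (node (node (node (node (leaf 14) (leaf 15)) (node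
      (node (node (leaf 14) (leaf 16)) (leaf 22)) (node (node (leaf 17) (leaf 22)) (leaf 22)))) (node (node
      (node (leaf 18) (leaf 20)) (leaf 23)) (node (node (node (leaf 20) (leaf 23)) (leaf 23)) (leaf 23))))
      (node (node (node (node (node (leaf 17) (leaf 18)) (node (leaf 20) (leaf 22))) (node (node (leaf 20)
      (leaf 23)) (leaf 23))) (leaf 23)) (node (node (node (node (leaf 20) (leaf 23)) (leaf 23)) (leaf 23))
      (leaf 23))))) (node (node (node (node (leaf 18) (node (leaf 0) (node (leaf 22) (node (leaf 19) (leaf
      22))))) (node (node (node (leaf 18) (leaf 20)) (leaf 24)) (node (node (node (leaf 21) (leaf 23)) (leaf
      24)) (leaf 24)))) (node (node (node (node (leaf 21) (leaf 22)) (node (node (leaf 23) (leaf 24)) (leaf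
      24))) (leaf 24)) (leaf 24))) (node (node (node (node (node (leaf 21) (leaf 22)) (leaf 24)) (leaf 24))
      (leaf 24)) (leaf 24)))) (node (node (node (node (node (node (leaf 14) (leaf 18)) (node (node (leaf 16)
      (leaf 22)) (node (node (leaf 19) (leaf 22)) (leaf 22)))) (node (node (node (leaf 18) (node (leaf 19)
      (leaf 20))) (node (node (leaf 21) (leaf 24)) (node (leaf 23) (leaf 24)))) (node (node (leaf 23) (leaf
      24)) (node (node (leaf 23) (leaf 24)) (leaf 24))))) (node (node (node (node (leaf 21) (leaf 22)) (node
      (node (leaf 21) (leaf 24)) (leaf 24))) (leaf 24)) (leaf 24))) (leaf 24)) (node (node (node (node (node
      (node (leaf 21) (leaf 24)) (node (node (leaf 23) (leaf 24)) (leaf 24))) (leaf 24)) (leaf 24)) (leaf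
      24)) (leaf 24)))))

  -- φ is opaque, so that only the certificate ever evaluates the table.
  opaque
    φ : ∀ {m} → Vec Bool (10 + m) → ℕ
    φ w = look table (take 10 w)

    φ-prefix : ∀ {m m′} (v : Vec Bool (10 + m)) (v′ : Vec Bool (10 + m′)) → take 10 v ≡ take 10 v′ → φ v ≡ φ v′
    φ-prefix v v′ same-prefix = cong (look table) same-prefix

  indicator : Bool → ℕ
  indicator true  = 1
  indicator false = 0

  discharges : Window → Bool
  discharges w = (4 + φ w) ≤ᵇ (11 * indicator (head w) + φ (tail w))

  allVectors : (m : ℕ) → (Vec Bool m → Bool) → Bool
  allVectors zero    p = p []
  allVectors (suc m) p = allVectors m (λ v → p (false ∷ v)) ∧ allVectors m (λ v → p (true ∷ v))

  allVectors-sound : ∀ m p → T (allVectors m p) → ∀ v → T (p v)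
  allVectors-sound zero    p all-p []          = all-p
  allVectors-sound (suc m) p all-p (false ∷ v) = allVectors-sound m (p ∘ (false ∷_)) (proj₁ (Equivalence.to T-∧ all-p)) v
  allVectors-sound (suc m) p all-p (true ∷ v)  = allVectors-sound m (p ∘ (true ∷_)) (proj₂ (Equivalence.to T-∧ all-p)) v

  checked : Window → Bool
  checked w = not (locallyValid w) ∨ discharges w

  opaque
    unfolding φ
    certificate : allVectors 13 checked ≡ true
    certificate = refl

  discharge : ∀ w → T (locallyValid w) → 4 + φ w ≤ 11 * indicator (head w) + φ (tail w)
  discharge w valid = ≤ᵇ⇒≤ _ _ (implies (locallyValid w) valid (allVectors-sound 13 checked (Equivalence.from T-≡ certificate) w))
    where
    implies : ∀ a {b} → T a → T (not a ∨ b) → T b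
    implies true _ b-holds = b-holds


module Neighbourhood (n : ℕ) .{{_ : NonZero n}} where
  open import Data.Nat
  open import Data.Nat.Properties
  open import Data.Nat.DivMod using ([m+kn]%n≡m%n)
  open import Data.Nat.Tactic.RingSolver using (solve-∀)
  open import Data.Fin using (Fin; toℕ)
  open import Data.List.Membership.Propositional using (_∈_)
  open import Data.List.Membership.Propositional.Properties using (∈-map⁺; ∈-map⁻)
  open import Data.List.Relation.Unary.Any using (here; there)
  open import Data.Product using (∃-syntax; _,_)
  open import Data.Sum using (inj₁; inj₂)
  open import Relation.Binary.PropositionalEquality
  open Residues n
  open Windows

  module _ (i a : ℕ) (W : Fin n) (W≡ : toℕ W ≡ (i + a + 3) % n) where
    private
      step : ∀ k e j → 3 + k ≡ e + j * n → (toℕ W + k) % n ≡ (i + (a + e)) % n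
      step k e j 3+k≡ = begin
        (toℕ W + k) % n            ≡⟨ cong (λ r → (r + k) % n) W≡ ⟩
        ((i + a + 3) % n + k) % n  ≡⟨ %-absorbˡ (i + a + 3) k ⟩
        (i + a + 3 + k) % n        ≡⟨ cong (_% n) (trans (+-assoc (i + a) 3 k) (cong (i + a +_) 3+k≡)) ⟩
        (i + a + (e + j * n)) % n  ≡⟨ cong (_% n) (regroup i a e (j * n)) ⟩
        (i + (a + e) + j * n) % n  ≡⟨ [m+kn]%n≡m%n (i + (a + e)) j n ⟩
        (i + (a + e)) % n          ∎
        where
        open ≡-Reasoning
        regroup : ∀ i a e m → i + a + (e + m) ≡ i + (a + e) + m
        regroup = solve-∀

      -- Stepping back by d ≤ 3 (written + 3n ∸ d in InClosedNbhd) lands at a + e, e + d = 3.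
      stepBack : ∀ d e → e + d ≡ 3 → (toℕ W + 3 * n ∸ d) % n ≡ (i + (a + e)) % n
      stepBack d e e+d≡3 = trans (cong (_% n) (+-∸-assoc (toℕ W) d≤3n)) (step (3 * n ∸ d) e 3 3+k≡)
        where
        d≤3n : d ≤ 3 * n
        d≤3n = ≤-trans (subst (d ≤_) e+d≡3 (m≤n+m d e)) (m≤m*n 3 n)
        3+k≡ : 3 + (3 * n ∸ d) ≡ e + 3 * n
        3+k≡ = begin
          3 + (3 * n ∸ d)        ≡⟨ cong (_+ (3 * n ∸ d)) (sym e+d≡3) ⟩
          e + d + (3 * n ∸ d)    ≡⟨ +-assoc e d (3 * n ∸ d) ⟩
          e + (d + (3 * n ∸ d))  ≡⟨ cong (e +_) (m+[n∸m]≡n d≤3n) ⟩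
          e + 3 * n              ∎
          where open ≡-Reasoning

      stay : toℕ W % n ≡ (i + (a + 3)) % n
      stay = trans (cong (_% n) (sym (+-identityʳ (toℕ W)))) (step 0 3 0 refl)

      at : ∀ {e} → e ∈ offsets → a + e ∈ nbhd a
      at = ∈-map⁺ (a +_)

    nbhd⇒window : ∀ {c} → InClosedNbhd n W c → ∃[ q ] q ∈ nbhd a × toℕ c ≡ (i + q) % n
    nbhd⇒window (inj₁ c≡)                      = a + 3 , at (there (there (here refl))) , trans c≡ stay
    nbhd⇒window (inj₂ (inj₁ c≡))               = a + 4 , at (there (there (there (here refl)))) , trans c≡ (step 1 4 0 refl)
    nbhd⇒window (inj₂ (inj₂ (inj₁ c≡)))        = a + 2 , at (there (here refl)) , trans c≡ (stepBack 1 2 refl)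
    nbhd⇒window (inj₂ (inj₂ (inj₂ (inj₁ c≡)))) = a + 6 , at (there (there (there (there (here refl))))) , trans c≡ (step 3 6 0 refl)
    nbhd⇒window (inj₂ (inj₂ (inj₂ (inj₂ c≡)))) = a + 0 , at (here refl) , trans c≡ (stepBack 3 0 refl)

    window⇒nbhd : ∀ {c q} → q ∈ nbhd a → toℕ c ≡ (i + q) % n → InClosedNbhd n W c
    window⇒nbhd q∈ c≡ with ∈-map⁻ (a +_) q∈
    ... | e , e∈ , refl = byOffset e∈ c≡
      where
      byOffset : ∀ {c e} → e ∈ offsets → toℕ c ≡ (i + (a + e)) % n → InClosedNbhd n W c
      byOffset (here refl)                                 c≡ = inj₂ (inj₂ (inj₂ (inj₂ (trans c≡ (sym (stepBack 3 0 refl))))))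
      byOffset (there (here refl))                         c≡ = inj₂ (inj₂ (inj₁ (trans c≡ (sym (stepBack 1 2 refl)))))
      byOffset (there (there (here refl)))                 c≡ = inj₁ (trans c≡ (sym stay))
      byOffset (there (there (there (here refl))))         c≡ = inj₂ (inj₁ (trans c≡ (sym (step 1 4 0 refl))))
      byOffset (there (there (there (there (here refl))))) c≡ = inj₂ (inj₂ (inj₂ (inj₁ (trans c≡ (sym (step 3 6 0 refl))))))


module CodeBits (n : ℕ) .{{_ : NonZero n}} (C : Subset n) where
  open import Data.Nat
  open import Data.Nat.Properties using (+-comm)
  open import Data.Nat.DivMod using ([m+n]%n≡m%n)
  open import Data.Bool using (Bool; T)
  open import Data.Bool.Properties using (T-≡)
  open import Data.Fin using (toℕ)
  open import Data.Fin.Subset using (_∈_)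
  open import Data.Vec using (lookup)
  open import Data.Vec.Properties using ([]=⇒lookup; lookup⇒[]=)
  open import Function using (_∘_; Equivalence)
  open import Relation.Binary.PropositionalEquality
  open Residues n
  open Windows

  codeword : ℕ → Bool
  codeword m = lookup C (vertex m)

  ∈⇒codeword : ∀ {c m} → c ∈ C → toℕ c ≡ m % n → T (codeword m)
  ∈⇒codeword c∈C c≡m = subst (T ∘ lookup C) (vertex-unique c≡m) (Equivalence.from T-≡ ([]=⇒lookup c∈C))

  codeword⇒∈ : ∀ {m} → T (codeword m) → vertex m ∈ C
  codeword⇒∈ {m} on = lookup⇒[]= (vertex m) C (Equivalence.to T-≡ on)

  codeword-periodic : ∀ m → codeword (n + m) ≡ codeword m
  codeword-periodic m = cong (lookup C) (vertex-unique (trans (toℕ-vertex (n + m)) n+m≡m))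
    where
    n+m≡m : (n + m) % n ≡ m % n
    n+m≡m = trans (cong (_% n) (+-comm n m)) ([m+n]%n≡m%n m n)

  codeWindow : ℕ → Window
  codeWindow i = window (λ t → codeword (i + t)) 13

  bit-codeWindow : ∀ i q → q < 13 → bit (codeWindow i) q ≡ codeword (i + q)
  bit-codeWindow i = bit-window (λ t → codeword (i + t)) 13


module Sums where
  open import Data.Nat
  open import Data.Nat.Properties
  open import Data.Nat.Tactic.RingSolver using (solve-∀)
  open import Data.Bool using (Bool; true; false)
  open import Data.Fin using (toℕ)
  import Data.Fin as Fin
  open import Data.Vec using (_∷_; []; lookup)
  open import Function using (_∘_)
  open import Relation.Binary.PropositionalEquality
  open Potential using (indicator)

  sumTo : ℕ → (ℕ → ℕ) → ℕ
  sumTo zero    f = 0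
  sumTo (suc m) f = f 0 + sumTo m (f ∘ suc)

  sumTo-*ˡ : ∀ k m f → sumTo m (λ i → k * f i) ≡ k * sumTo m f
  sumTo-*ˡ k zero    f = sym (*-zeroʳ k)
  sumTo-*ˡ k (suc m) f = trans (cong (k * f 0 +_) (sumTo-*ˡ k m (f ∘ suc))) (sym (*-distribˡ-+ k (f 0) _))

  telescope : ∀ a (φ c : ℕ → ℕ) → (∀ i → a + φ i ≤ c i + φ (suc i)) →
              ∀ m → m * a + φ 0 ≤ sumTo m c + φ m
  telescope a φ c gain zero    = ≤-refl
  telescope a φ c gain (suc m) = begin
    suc m * a + φ 0                         ≡⟨ shuffle a (m * a) (φ 0) ⟩
    m * a + (a + φ 0)                       ≤⟨ +-monoʳ-≤ (m * a) (gain 0) ⟩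
    m * a + (c 0 + φ 1)                     ≡⟨ swap (m * a) (c 0) (φ 1) ⟩
    c 0 + (m * a + φ 1)                     ≤⟨ +-monoʳ-≤ (c 0) (telescope a (φ ∘ suc) (c ∘ suc) (gain ∘ suc) m) ⟩
    c 0 + (sumTo m (c ∘ suc) + φ (suc m))   ≡⟨ sym (+-assoc (c 0) _ _) ⟩
    sumTo (suc m) c + φ (suc m)             ∎
    where
    open ≤-Reasoning
    shuffle : ∀ a ma p → a + ma + p ≡ ma + (a + p)
    shuffle = solve-∀
    swap : ∀ ma c p → ma + (c + p) ≡ c + (ma + p)
    swap = solve-∀

  sumTo-indicator : ∀ {m} (D : Subset m) (g : ℕ → Bool) → (∀ k → g (toℕ k) ≡ lookup D k) →
                    sumTo m (indicator ∘ g) ≡ ∣ D ∣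
  sumTo-indicator []          g g≡D = refl
  sumTo-indicator (true  ∷ D) g g≡D rewrite g≡D Fin.zero = cong suc (sumTo-indicator D (g ∘ suc) (g≡D ∘ Fin.suc))
  sumTo-indicator (false ∷ D) g g≡D rewrite g≡D Fin.zero = sumTo-indicator D (g ∘ suc) (g≡D ∘ Fin.suc)


-- In an identifying code every window is locally valid (each of
-- its centres is dominated, and two of its centres are distinct vertices, so
-- some codeword separates them, and such a codeword lies inside the window).
-- Discharging along the cycle then gives 4n ≤ 11|C|.
module LowerBound (n : ℕ) .{{_ : NonZero n}} (C : Subset n) (identifying : IsIdentifying n C) (11≤n : 11 ≤ n) where
  open import Data.Nat
  open import Data.Nat.Properties
  open import Data.Bool using (T; T?)
  open import Data.Fin using (Fin; toℕ)
  open import Data.Fin.Subset using (_∈_)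
  open import Data.List.Membership.Propositional using () renaming (_∈_ to _∈ℓ_)
  open import Data.List.Membership.DecPropositional _≟_ using (_∈?_)
  open import Data.Product using (∃-syntax; _,_; proj₁; proj₂)
  open import Data.Empty using (⊥-elim)
  open import Data.Vec using (tail; lookup)
  open import Data.Nat.Tactic.RingSolver using (solve-∀)
  open import Function using (_∘_; mk⇔)
  open import Relation.Nullary using (yes; no)
  open import Relation.Binary.PropositionalEquality
  open Residues n
  open Windows
  open Potential
  open Neighbourhood n
  open CodeBits n C
  open Sums

  centre : ℕ → ℕ → Fin n
  centre i a = vertex (i + a + 3)

  private
    bit-on : ∀ {i q c} → c ∈ C → toℕ c ≡ (i + q) % n → q ≤ 12 → T (bit (codeWindow i) q)
    bit-on {i} {q} c∈C c≡ q≤12 = subst T (sym (bit-codeWindow i q (s≤s q≤12))) (∈⇒codeword c∈C c≡)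

    position≤12 : ∀ {a q} → a ≤ 6 → q ∈ℓ nbhd a → q ≤ 12
    position≤12 {a} a≤6 q∈ = ≤-trans (proj₂ (nbhd-range q∈)) (+-monoˡ-≤ 6 a≤6)

  dominated-centre : ∀ i a → a ≤ 6 → T (dominated (codeWindow i) a)
  dominated-centre i a a≤6 with proj₁ (proj₂ identifying) (centre i a)
  ... | c , c∈C , c∈N with nbhd⇒window i a (centre i a) (toℕ-vertex _) c∈N
  ...   | q , q∈ , c≡ = any-intro (bit (codeWindow i)) q∈ (bit-on c∈C c≡ (position≤12 a≤6 q∈))

  -- Centres of one window are distinct vertices, as 6 < n.
  centres-distinct : ∀ i {a b} → a < b → b ≤ 6 → centre i a ≢ centre i b
  centres-distinct i {a} {b} a<b b≤6 same =
    <⇒≢ a<b (+-cancelˡ-≡ i a b (+-cancelʳ-≡ 3 (i + a) (i + b) positions≡))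
    where
    b<a+n : b < a + n
    b<a+n = ≤-trans (s≤s b≤6) (≤-trans (≤-trans (m≤m+n 7 4) 11≤n) (m≤n+m n a))
    apart : i + b + 3 < i + a + 3 + n
    apart = subst (i + b + 3 <_) (regroup i a n) (+-monoˡ-< 3 (+-monoʳ-< i b<a+n))
      where
      regroup : ∀ i a n → i + (a + n) + 3 ≡ i + a + 3 + n
      regroup = solve-∀
    positions≡ : i + a + 3 ≡ i + b + 3
    positions≡ = residue-injective (trans (sym (toℕ-vertex _)) (trans (cong toℕ same) (toℕ-vertex _)))
                   (+-monoˡ-≤ 3 (+-monoʳ-≤ i (<⇒≤ a<b))) apart

  transfer : ∀ i a b → a ≤ 6 → (∀ {q} → q ∈ℓ nbhd a → T (bit (codeWindow i) q) → q ∈ℓ nbhd b) →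
             ∀ {c} → c ∈ C × InClosedNbhd n (centre i a) c → c ∈ C × InClosedNbhd n (centre i b) c
  transfer i a b a≤6 stays (c∈C , c∈N) with nbhd⇒window i a (centre i a) (toℕ-vertex _) c∈N
  ... | q , q∈ , c≡ = c∈C , window⇒nbhd i b (centre i b) (toℕ-vertex _) (stays q∈ (bit-on c∈C c≡ (position≤12 a≤6 q∈))) c≡

  -- Otherwise the two centres would have the same identifying set.
  separated-centres : ∀ i a b → a < b → b ≤ 6 → T (separated (codeWindow i) a b)
  separated-centres i a b a<b b≤6 with T? (separated (codeWindow i) a b)
  ... | yes sep  = sep
  ... | no ¬sep = ⊥-elim (proj₂ (proj₂ identifying) (centre i a) (centre i b) (centres-distinct i a<b b≤6)
                    (λ c → mk⇔ (transfer i a b a≤6 (stays separatorˡ)) (transfer i b a b≤6 (stays separatorʳ))))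
    where
    a≤6 = ≤-trans (<⇒≤ a<b) b≤6
    w = codeWindow i
    stays : ∀ {x y} → (∀ {q} → q ∈ℓ nbhd x → ¬ q ∈ℓ nbhd y → q ∈ℓ separators a b) →
            ∀ {q} → q ∈ℓ nbhd x → T (bit w q) → q ∈ℓ nbhd y
    stays {y = y} separator {q} q∈x on with q ∈? nbhd y
    ... | yes q∈y = q∈y
    ... | no  q∉y = ⊥-elim (¬sep (any-intro (bit w) (separator q∈x q∉y) on))

  windows-valid : ∀ i → T (locallyValid (codeWindow i))
  windows-valid i = valid-intro (codeWindow i)
    (λ a a<7 → dominated-centre i a (≤-pred a<7))
    (λ a b a<b b<7 → separated-centres i a b a<b (≤-pred b<7))

  potential : ℕ → ℕ
  potential i = φ (codeWindow i)

  gain : ∀ i → 4 + potential i ≤ 11 * indicator (codeword i) + potential (suc i)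
  gain i = subst₂ (λ x p → 4 + potential i ≤ 11 * indicator x + p)
             (cong codeword (+-identityʳ i)) next (discharge (codeWindow i) (windows-valid i))
    where
    next : φ (tail (codeWindow i)) ≡ potential (suc i)
    next = φ-prefix _ _ (window-cong 10 (λ t _ → cong codeword (+-suc i t)))

  potential-periodic : potential n ≡ potential 0
  potential-periodic = cong φ (window-cong 13 (λ t _ → codeword-periodic t))

  lower-bound : 4 * n ≤ 11 * ∣ C ∣
  lower-bound = +-cancelʳ-≤ (potential 0) _ _ (begin
    4 * n + potential 0                                ≡⟨ cong (_+ potential 0) (*-comm 4 n) ⟩
    n * 4 + potential 0                                ≤⟨ telescope 4 potential (λ i → 11 * indicator (codeword i)) gain n ⟩
    sumTo n (λ i → 11 * indicator (codeword i)) + potential n ≡⟨ cong₂ _+_ count potential-periodic ⟩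
    11 * ∣ C ∣ + potential 0                           ∎)
    where
    open ≤-Reasoning
    count : sumTo n (λ i → 11 * indicator (codeword i)) ≡ 11 * ∣ C ∣
    count = trans (sumTo-*ˡ 11 n (indicator ∘ codeword))
                  (cong (11 *_) (sumTo-indicator C codeword (λ k → cong (lookup C) (vertex-toℕ k))))


-- For n ≥ 13 a code all of whose windows are locally
-- valid is identifying: two vertices at cyclic distance d ≤ 6 are centres of a
-- common window, which contains a codeword separating them; at distance ≥ 7 a
-- codeword dominating one of them is too far away from the other.
module LocalToGlobal (n : ℕ) .{{_ : NonZero n}} (C : Subset n) (13≤n : 13 ≤ n)
                     (valid : ∀ i → T (Windows.locallyValid (CodeBits.codeWindow n C i))) where
  open import Data.Nat
  open import Data.Nat.Properties
  open import Data.Nat.Tactic.RingSolver using (solve-∀)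
  open import Data.Fin using (Fin; toℕ)
  import Data.Fin.Properties as Fin
  open import Data.Fin.Subset using (_∈_)
  open import Data.List.Membership.Propositional using () renaming (_∈_ to _∈ℓ_)
  open import Data.Product using (∃-syntax; _,_; proj₁; proj₂)
  open import Data.Sum using (inj₁; inj₂)
  open import Data.Empty using (⊥-elim)
  open import Function using (_⇔_; mk⇔; Equivalence)
  open import Relation.Nullary using (yes; no)
  open import Relation.Binary.Definitions using (tri<; tri≈; tri>)
  open import Relation.Binary.PropositionalEquality
  open Residues n
  open Windows
  open Neighbourhood n
  open CodeBits n C

  CentreOf : ℕ → ℕ → Fin n → Set
  CentreOf p a U = toℕ U ≡ (p + a + 3) % n

  Separable : Fin n → Fin n → Set
  Separable U W = ∃[ c ] c ∈ C × ((InClosedNbhd n U c × ¬ InClosedNbhd n W c) ⊎ (InClosedNbhd n W c × ¬ InClosedNbhd n U c))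

  separable-sym : ∀ {U W} → Separable U W → Separable W U
  separable-sym (c , c∈C , inj₁ only-U) = c , c∈C , inj₂ only-U
  separable-sym (c , c∈C , inj₂ only-W) = c , c∈C , inj₁ only-W

  separable⇒distinct : ∀ {U W} → Separable U W →
                       ¬ (∀ c → (c ∈ C × InClosedNbhd n U c) ⇔ (c ∈ C × InClosedNbhd n W c))
  separable⇒distinct (c , c∈C , inj₁ (c∈U , c∉W)) same = c∉W (proj₂ (Equivalence.to (same c) (c∈C , c∈U)))
  separable⇒distinct (c , c∈C , inj₂ (c∈W , c∉U)) same = c∉U (proj₂ (Equivalence.from (same c) (c∈C , c∈W)))

  private
    -- Positions of one window name distinct vertices, as 12 < n.
    positions-injective : ∀ p {q q′} → q ≤ 12 → q′ ≤ 12 → (p + q) % n ≡ (p + q′) % n → q ≡ q′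
    positions-injective p {q} {q′} q≤12 q′≤12 same = +-cancelˡ-≡ p q q′ (residue-injective′ same (apart q≤12) (apart q′≤12))
      where
      apart : ∀ {x y} → x ≤ 12 → p + x < p + y + n
      apart {x} {y} x≤12 = subst (p + x <_) (sym (+-assoc p y n)) (+-monoʳ-< p (≤-trans (s≤s x≤12) (≤-trans 13≤n (m≤n+m n y))))

    position≤12 : ∀ {a q} → a ≤ 6 → q ∈ℓ nbhd a → q ≤ 12
    position≤12 {a} a≤6 q∈ = ≤-trans (proj₂ (nbhd-range q∈)) (+-monoˡ-≤ 6 a≤6)

    window-codeword : ∀ {p q} → q ≤ 12 → T (bit (codeWindow p) q) → vertex (p + q) ∈ C
    window-codeword {p} {q} q≤12 on = codeword⇒∈ (subst T (bit-codeWindow p q (s≤s q≤12)) on)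

  near⇔ : ∀ {p a U} q → CentreOf p a U → a ≤ 6 → q ≤ 12 → InClosedNbhd n U (vertex (p + q)) ⇔ q ∈ℓ nbhd a
  near⇔ {p} {a} {U} q U≡ a≤6 q≤12 = mk⇔ to (λ q∈ → window⇒nbhd p a U U≡ q∈ (toℕ-vertex (p + q)))
    where
    to : InClosedNbhd n U (vertex (p + q)) → q ∈ℓ nbhd a
    to near with nbhd⇒window p a U U≡ near
    ... | q′ , q′∈ , v≡ = subst (_∈ℓ nbhd a) (sym (positions-injective p q≤12 (position≤12 a≤6 q′∈)
                                                  (trans (sym (toℕ-vertex (p + q))) v≡))) q′∈

  dominator : ∀ {p U} → CentreOf p 0 U → ∃[ q ] q ≤ 6 × vertex (p + q) ∈ C × InClosedNbhd n U (vertex (p + q))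
  dominator {p} {U} U≡ with any-witness (bit (codeWindow p)) (valid⇒dominated {codeWindow p} {0} (valid p) (s≤s z≤n))
  ... | q , q∈ , on = q , q≤6 , window-codeword (≤-trans q≤6 (m≤m+n 6 6)) on ,
                      Equivalence.from (near⇔ q U≡ z≤n (≤-trans q≤6 (m≤m+n 6 6))) q∈
    where
    q≤6 : q ≤ 6
    q≤6 = proj₂ (nbhd-range q∈)

  separate-near : ∀ {p d U W} → 0 < d → d ≤ 6 → CentreOf p 0 U → CentreOf p d W → Separable U W
  separate-near {p} {d} {U} {W} 0<d d≤6 U≡ W≡
    with any-witness (bit (codeWindow p)) (valid⇒separated {codeWindow p} {0} {d} (valid p) 0<d (s≤s d≤6))
  ... | q , q∈ , on with separator⁻ q∈
  ...   | inj₁ (q∈U , q∉W) = vertex (p + q) , window-codeword (position≤12 z≤n q∈U) on ,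
                             inj₁ (Equivalence.from (near⇔ q U≡ z≤n (position≤12 z≤n q∈U)) q∈U ,
                                   λ near → q∉W (Equivalence.to (near⇔ q W≡ d≤6 (position≤12 z≤n q∈U)) near))
  ...   | inj₂ (q∈W , q∉U) = vertex (p + q) , window-codeword (position≤12 d≤6 q∈W) on ,
                             inj₂ (Equivalence.from (near⇔ q W≡ d≤6 (position≤12 d≤6 q∈W)) q∈W ,
                                   λ near → q∉U (Equivalence.to (near⇔ q U≡ z≤n (position≤12 d≤6 q∈W)) near))

  -- Centres at distance 7 ≤ d ≤ n − 7: a codeword dominating U is far from W.
  separate-far : ∀ {p d U W} → 7 ≤ d → d + 7 ≤ n → CentreOf p 0 U → CentreOf p d W → Separable U W
  separate-far {p} {d} {U} {W} 7≤d d+7≤n U≡ W≡ with dominator U≡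
  ... | q , q≤6 , c∈C , c∈U = vertex (p + q) , c∈C , inj₁ (c∈U , c∉W)
    where
    c∉W : ¬ InClosedNbhd n W (vertex (p + q))
    c∉W near with nbhd⇒window p d W W≡ near
    ... | q′ , q′∈ , v≡ = <⇒≢ q<q′ (+-cancelˡ-≡ p q q′ (residue-injective (trans (sym (toℕ-vertex (p + q))) v≡)
                                                          (+-monoʳ-≤ p (<⇒≤ q<q′)) apart))
      where
      q<q′ : q < q′
      q<q′ = ≤-trans (s≤s q≤6) (≤-trans 7≤d (proj₁ (nbhd-range q′∈)))
      apart : p + q′ < p + q + n
      apart = subst (p + q′ <_) (sym (+-assoc p q n))
                (+-monoʳ-< p (≤-trans (s≤s (proj₂ (nbhd-range q′∈))) (≤-trans (≤-reflexive (sym (+-suc d 6)))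
                  (≤-trans d+7≤n (m≤n+m n q)))))

  private
    n∸3 : ℕ
    n∸3 = n ∸ 3

    3+[n∸3]≡n : 3 + n∸3 ≡ n
    3+[n∸3]≡n = m+[n∸m]≡n (≤-trans (m≤m+n 3 10) 13≤n)

    -- W = U + d is the centre d of the window starting n − 3 after U, i.e. 3 before it.
    centre-after : ∀ (U W : Fin n) d → toℕ U + d ≡ toℕ W → CentreOf (toℕ U + n∸3) d W
    centre-after U W d u+d≡w = named-by W 1 (begin
      toℕ U + n∸3 + d + 3        ≡⟨ regroup (toℕ U) n∸3 d ⟩
      toℕ U + d + 1 * (3 + n∸3)  ≡⟨ cong₂ (λ w k → w + 1 * k) u+d≡w 3+[n∸3]≡n ⟩
      toℕ W + 1 * n              ∎)
      where
      open ≡-Reasoning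
      regroup : ∀ u m d → u + m + d + 3 ≡ u + d + 1 * (3 + m)
      regroup = solve-∀

    -- … and, going once around, U = W + (n − d) is the centre n − d of the window 3 before W.
    centre-around : ∀ (U W : Fin n) d d′ → toℕ U + d ≡ toℕ W → d + d′ ≡ n → CentreOf (toℕ W + n∸3) d′ U
    centre-around U W d d′ u+d≡w d+d′≡n = named-by U 2 (begin
      toℕ W + n∸3 + d′ + 3                  ≡⟨ cong (λ w → w + n∸3 + d′ + 3) (sym u+d≡w) ⟩
      toℕ U + d + n∸3 + d′ + 3              ≡⟨ regroup (toℕ U) d n∸3 d′ ⟩
      toℕ U + 1 * (d + d′) + 1 * (3 + n∸3)  ≡⟨ cong₂ (λ k l → toℕ U + 1 * k + 1 * l) d+d′≡n 3+[n∸3]≡n ⟩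
      toℕ U + 1 * n + 1 * n                 ≡⟨ twice (toℕ U) n ⟩
      toℕ U + 2 * n                         ∎)
      where
      open ≡-Reasoning
      regroup : ∀ u d m d′ → u + d + m + d′ + 3 ≡ u + 1 * (d + d′) + 1 * (3 + m)
      regroup = solve-∀
      twice : ∀ u n → u + 1 * n + 1 * n ≡ u + 2 * n
      twice = solve-∀

  -- Vertices U, W with toℕ W = toℕ U + d, 0 < d < n, are separable: by the
  -- distances d and n − d, one of the two previous cases applies.
  separate-ordered : ∀ (U W : Fin n) d d′ → 0 < d → 0 < d′ → toℕ U + d ≡ toℕ W → d + d′ ≡ n → Separable U W
  separate-ordered U W d d′ 0<d 0<d′ u+d≡w d+d′≡n with d ≤? 6 | d′ ≤? 6
  ... | yes d≤6 | _        = separate-near 0<d d≤6 (centre-after U U 0 (+-identityʳ _)) (centre-after U W d u+d≡w)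
  ... | no  d≰6 | yes d′≤6 = separable-sym (separate-near 0<d′ d′≤6 (centre-after W W 0 (+-identityʳ _))
                                                                    (centre-around U W d d′ u+d≡w d+d′≡n))
  ... | no  d≰6 | no  d′≰6 = separate-far (≰⇒> d≰6) (subst (d + 7 ≤_) d+d′≡n (+-monoʳ-≤ d (≰⇒> d′≰6)))
                               (centre-after U U 0 (+-identityʳ _)) (centre-after U W d u+d≡w)

  separate-< : ∀ (U W : Fin n) → toℕ U < toℕ W → Separable U W
  separate-< U W u<w = separate-ordered U W d (n ∸ d) (m<n⇒0<n∸m u<w) (m<n⇒0<n∸m d<n)
                         (m+[n∸m]≡n (<⇒≤ u<w)) (m+[n∸m]≡n (<⇒≤ d<n))
    where
    d = toℕ W ∸ toℕ U
    d<n : d < n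
    d<n = ≤-<-trans (m∸n≤m (toℕ W) (toℕ U)) (Fin.toℕ<n W)

  separate : ∀ (U W : Fin n) → U ≢ W → Separable U W
  separate U W U≢W with <-cmp (toℕ U) (toℕ W)
  ... | tri< u<w _ _ = separate-< U W u<w
  ... | tri≈ _ u≡w _ = ⊥-elim (U≢W (Fin.toℕ-injective u≡w))
  ... | tri> _ _ w<u = separable-sym (separate-< W U w<u)

  -- Every vertex is the centre 0 of the window starting n − 3 before it.
  dominated-everywhere : ∀ (U : Fin n) → ∃[ c ] c ∈ C × InClosedNbhd n U c
  dominated-everywhere U = forget (dominator (centre-after U U 0 (+-identityʳ (toℕ U))))
    where
    forget : ∀ {p} → ∃[ q ] q ≤ 6 × vertex (p + q) ∈ C × InClosedNbhd n U (vertex (p + q)) → ∃[ c ] c ∈ C × InClosedNbhd n U c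
    forget (q , _ , c∈C , c∈U) = _ , c∈C , c∈U

  identifying : IsIdentifying n C
  identifying = (proj₁ some-codeword , proj₁ (proj₂ some-codeword)) , dominated-everywhere ,
                (λ U W U≢W → separable⇒distinct (separate U W U≢W))
    where
    some-codeword = dominated-everywhere (vertex 0)


module Words where
  open import Data.Nat
  open import Data.Nat.Properties
  open import Data.Nat.DivMod using (m%n<n; m<n⇒m%n≡m; [m+n]%n≡m%n)
  open import Data.Bool using (Bool; true; false; _∧_)
  open import Data.Bool.Properties using (T-∧; T-≡)
  open import Data.List using (List; []; _∷_; _++_; length; take; drop)
  open import Data.Fin using (Fin; toℕ)
  open import Data.Vec using (tabulate)
  open import Data.Vec.Properties using (lookup∘tabulate)
  open import Data.Product using (proj₁; proj₂)
  open import Function using (_∘_; Equivalence)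
  open import Relation.Nullary using (yes; no)
  open import Relation.Binary.PropositionalEquality
  open Windows

  letter : List Bool → ℕ → Bool
  letter []      _       = false
  letter (b ∷ w) zero    = b
  letter (b ∷ w) (suc q) = letter w q

  letter-++ˡ : ∀ u v {q} → q < length u → letter (u ++ v) q ≡ letter u q
  letter-++ˡ (b ∷ u) v {zero}  _         = refl
  letter-++ˡ (b ∷ u) v {suc q} (s≤s q<u) = letter-++ˡ u v q<u

  letter-++ʳ : ∀ u v s → letter (u ++ v) (length u + s) ≡ letter v s
  letter-++ʳ []      v s = refl
  letter-++ʳ (b ∷ u) v s = letter-++ʳ u v s

  letter-take : ∀ k u {q} → q < k → letter (take k u) q ≡ letter u q
  letter-take (suc k) []      _         = refl
  letter-take (suc k) (b ∷ u) {zero}  _ = refl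
  letter-take (suc k) (b ∷ u) {suc q} (s≤s q<k) = letter-take k u q<k

  letter-drop : ∀ i u q → letter (drop i u) q ≡ letter u (i + q)
  letter-drop zero    u       q = refl
  letter-drop (suc i) []      q = refl
  letter-drop (suc i) (b ∷ u) q = letter-drop i u q

  weight : List Bool → ℕ
  weight []          = 0
  weight (true ∷ w)  = suc (weight w)
  weight (false ∷ w) = weight w

  weight-++ : ∀ u v → weight (u ++ v) ≡ weight u + weight v
  weight-++ []          v = refl
  weight-++ (true ∷ u)  v = cong suc (weight-++ u v)
  weight-++ (false ∷ u) v = weight-++ u v

  validWindows : ℕ → List Bool → Bool
  validWindows zero    u       = true
  validWindows (suc k) []      = false
  validWindows (suc k) (b ∷ u) = locallyValid (window (letter (b ∷ u)) 13) ∧ validWindows k u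

  validWindows-sound : ∀ k u → T (validWindows k u) → ∀ {i} → i < k → T (locallyValid (window (letter (drop i u)) 13))
  validWindows-sound (suc k) (b ∷ u) valid {zero}  _         = proj₁ (Equivalence.to T-∧ valid)
  validWindows-sound (suc k) (b ∷ u) valid {suc i} (s≤s i<k) =
    validWindows-sound k u (proj₂ (Equivalence.to (T-∧ {locallyValid (window (letter (b ∷ u)) 13)}) valid)) i<k

  -- All windows of w, read cyclically, are locally valid: w is followed by its first 12 letters.
  cyclicallyValid : List Bool → Bool
  cyclicallyValid w = validWindows (length w) (w ++ take 12 w)

  wordCode : (n : ℕ) → List Bool → Subset n
  wordCode n w = tabulate (letter w ∘ toℕ)

  wordCode-size : ∀ n w → length w ≡ n → ∣ wordCode n w ∣ ≡ weight w
  wordCode-size zero    []          _   = refl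
  wordCode-size (suc n) (true ∷ w)  len = cong suc (wordCode-size n w (suc-injective len))
  wordCode-size (suc n) (false ∷ w) len = wordCode-size n w (suc-injective len)

  module _ (n : ℕ) .{{_ : NonZero n}} (w : List Bool) (len : length w ≡ n) (13≤n : 13 ≤ n) where
    open Residues n
    open CodeBits n (wordCode n w)

    codeword-wordCode : ∀ m → codeword m ≡ letter w (m % n)
    codeword-wordCode m = trans (lookup∘tabulate (letter w ∘ toℕ) (vertex m)) (cong (letter w) (toℕ-vertex m))

    cyclic-letter : ∀ s → s < n + 12 → letter (w ++ take 12 w) s ≡ letter w (s % n)
    cyclic-letter s s<n+12 with s <? n
    ... | yes s<n = trans (letter-++ˡ w (take 12 w) (subst (s <_) (sym len) s<n)) (cong (letter w) (sym (m<n⇒m%n≡m s<n)))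
    ... | no  s≮n = begin
      letter (w ++ take 12 w) s              ≡⟨ cong (letter (w ++ take 12 w)) s≡ ⟩
      letter (w ++ take 12 w) (length w + t) ≡⟨ letter-++ʳ w (take 12 w) t ⟩
      letter (take 12 w) t                   ≡⟨ letter-take 12 w t<12 ⟩
      letter w t                             ≡⟨ cong (letter w) (sym s%n≡t) ⟩
      letter w (s % n)                       ∎
      where
      open ≡-Reasoning
      t = s ∸ n
      n≤s = ≮⇒≥ s≮n
      s≡ : s ≡ length w + t
      s≡ = trans (sym (m+[n∸m]≡n n≤s)) (cong (_+ t) (sym len))
      t<12 : t < 12
      t<12 = +-cancelˡ-< n t 12 (subst (_< n + 12) (sym (m+[n∸m]≡n n≤s)) s<n+12)
      s%n≡t : s % n ≡ t
      s%n≡t = begin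
        s % n         ≡⟨ cong (_% n) (trans (sym (m+[n∸m]≡n n≤s)) (+-comm n t)) ⟩
        (t + n) % n   ≡⟨ [m+n]%n≡m%n t n ⟩
        t % n         ≡⟨ m<n⇒m%n≡m (≤-trans t<12 (≤-trans (n≤1+n 12) 13≤n)) ⟩
        t             ∎

    codeWindow-word : ∀ i → codeWindow i ≡ window (letter (drop (i % n) (w ++ take 12 w))) 13
    codeWindow-word i = window-cong 13 same
      where
      same : ∀ t → t < 13 → codeword (i + t) ≡ letter (drop (i % n) (w ++ take 12 w)) t
      same t t<13 = sym (begin
        letter (drop (i % n) (w ++ take 12 w)) t  ≡⟨ letter-drop (i % n) (w ++ take 12 w) t ⟩
        letter (w ++ take 12 w) (i % n + t)       ≡⟨ cyclic-letter (i % n + t) (+-mono-<-≤ (m%n<n i n) (≤-pred t<13)) ⟩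
        letter w ((i % n + t) % n)                ≡⟨ cong (letter w) (%-absorbˡ i t) ⟩
        letter w ((i + t) % n)                    ≡⟨ sym (codeword-wordCode (i + t)) ⟩
        codeword (i + t)                          ∎)
        where open ≡-Reasoning

    wordCode-identifying : cyclicallyValid w ≡ true → IsIdentifying n (wordCode n w)
    wordCode-identifying cyclic = LocalToGlobal.identifying n (wordCode n w) 13≤n windows-valid
      where
      windows-valid : ∀ i → T (locallyValid (codeWindow i))
      windows-valid i = subst (T ∘ locallyValid) (sym (codeWindow-word i))
        (validWindows-sound (length w) (w ++ take 12 w) (Equivalence.from T-≡ cyclic) (subst (i % n <_) (sym len) (m%n<n i n)))


-- Identifying codes of Z_n are decidable: all quantifiers range over Fin n.
module Decision (n : ℕ) .{{_ : NonZero n}} where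
  open import Data.Nat using (_≟_; _∸_)
  open import Data.Fin using (Fin; toℕ)
  import Data.Fin.Properties as Fin
  open import Data.Fin.Subset using (_∈_)
  open import Data.Fin.Subset.Properties using (_∈?_)
  open import Data.Product using (_,_)
  open import Data.Empty using (⊥-elim)
  open import Function using (_⇔_; mk⇔; Equivalence)
  open import Relation.Nullary using (Dec; yes; no)
  open import Relation.Nullary.Decidable using (_×-dec_; _⊎-dec_; _→-dec_; ¬?)

  _⇔?_ : ∀ {A B : Set} → Dec A → Dec B → Dec (A ⇔ B)
  yes a ⇔? yes b = yes (mk⇔ (λ _ → b) (λ _ → a))
  no ¬a ⇔? no ¬b = yes (mk⇔ (λ a → ⊥-elim (¬a a)) (λ b → ⊥-elim (¬b b)))
  yes a ⇔? no ¬b = no (λ a⇔b → ¬b (Equivalence.to a⇔b a))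
  no ¬a ⇔? yes b = no (λ a⇔b → ¬a (Equivalence.from a⇔b b))

  nbhd? : ∀ u v → Dec (InClosedNbhd n u v)
  nbhd? u v = (toℕ v ≟ toℕ u % n) ⊎-dec (toℕ v ≟ (toℕ u + 1) % n) ⊎-dec (toℕ v ≟ (toℕ u + 3 * n ∸ 1) % n)
              ⊎-dec (toℕ v ≟ (toℕ u + 3) % n) ⊎-dec (toℕ v ≟ (toℕ u + 3 * n ∸ 3) % n)

  identifying? : ∀ C → Dec (IsIdentifying n C)
  identifying? C =
    Fin.any? (λ c → c ∈? C)
    ×-dec Fin.all? (λ u → Fin.any? (λ c → (c ∈? C) ×-dec nbhd? u c))
    ×-dec Fin.all? (λ u → Fin.all? (λ v → ¬? (u Fin.≟ v) →-dec
                     ¬? (Fin.all? (λ c → ((c ∈? C) ×-dec nbhd? u c) ⇔? ((c ∈? C) ×-dec nbhd? v c)))))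


-- With the period P = 11001100000 (4 codewords in 11 letters)
-- and blocks B_r of length 11 + r found by computer, the word P^k B_r has length
-- n = r + (k + 1)·11 and weight ⌈4n/11⌉ + excess r.  Its cyclic windows are all
-- locally valid: for k = 0 this is checked directly (n ≥ 13), and for k ≥ 1 every
-- window of P^k B_r followed by its first 12 letters already occurs in P B_r P1,
-- which is checked once per r.
module Construction where
  open import Data.Nat
  open import Data.Nat.Properties
  open import Data.Nat.Tactic.RingSolver using (solve-∀)
  open import Data.Bool using (Bool; true; T; _∧_; _∨_)
  open import Data.Bool.Properties using (T-∧; T-∨; T-≡)
  open import Data.Bool.ListAction using (all)
  open import Data.List using (List; []; _∷_; _++_; length; take; map; upTo)
  open import Data.List.Properties using (length-++)
  open import Data.List.Membership.Propositional.Properties using (∈-upTo⁺)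
  open import Data.Product using (_,_; proj₁; proj₂)
  open import Data.Sum using (_⊎_; inj₁; inj₂)
  open import Data.Empty using (⊥-elim)
  open import Function using (Equivalence)
  open import Relation.Nullary using (Dec)
  open import Relation.Nullary.Decidable using (isYes; toWitness)
  open import Relation.Binary.PropositionalEquality
  open Windows
  open Words

  bits : List ℕ → List Bool
  bits = map (_≡ᵇ 1)

  period : List Bool
  period = bits (1 ∷ 1 ∷ 0 ∷ 0 ∷ 1 ∷ 1 ∷ 0 ∷ 0 ∷ 0 ∷ 0 ∷ 0 ∷ [])

  repeat : ℕ → List Bool
  repeat zero    = []
  repeat (suc k) = period ++ repeat k

  blockTail : ℕ → List Bool
  blockTail 0  = bits (1 ∷ 0 ∷ 0 ∷ 1 ∷ 1 ∷ 0 ∷ 0 ∷ 0 ∷ 0 ∷ 0 ∷ [])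
  blockTail 1  = bits (1 ∷ 1 ∷ 0 ∷ 0 ∷ 1 ∷ 1 ∷ 0 ∷ 0 ∷ 0 ∷ 0 ∷ 0 ∷ [])
  blockTail 2  = bits (1 ∷ 1 ∷ 1 ∷ 0 ∷ 0 ∷ 1 ∷ 1 ∷ 0 ∷ 0 ∷ 0 ∷ 0 ∷ 0 ∷ [])
  blockTail 3  = bits (1 ∷ 1 ∷ 0 ∷ 0 ∷ 0 ∷ 1 ∷ 1 ∷ 1 ∷ 0 ∷ 0 ∷ 0 ∷ 0 ∷ 0 ∷ [])
  blockTail 4  = bits (1 ∷ 0 ∷ 0 ∷ 1 ∷ 1 ∷ 0 ∷ 0 ∷ 1 ∷ 1 ∷ 0 ∷ 0 ∷ 0 ∷ 0 ∷ 0 ∷ [])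
  blockTail 5  = bits (1 ∷ 1 ∷ 1 ∷ 0 ∷ 0 ∷ 0 ∷ 1 ∷ 0 ∷ 1 ∷ 1 ∷ 0 ∷ 0 ∷ 0 ∷ 0 ∷ 0 ∷ [])
  blockTail 6  = bits (1 ∷ 1 ∷ 1 ∷ 0 ∷ 0 ∷ 0 ∷ 0 ∷ 1 ∷ 0 ∷ 0 ∷ 1 ∷ 1 ∷ 0 ∷ 0 ∷ 0 ∷ 0 ∷ [])
  blockTail 7  = bits (1 ∷ 0 ∷ 1 ∷ 0 ∷ 0 ∷ 0 ∷ 1 ∷ 1 ∷ 0 ∷ 0 ∷ 1 ∷ 1 ∷ 0 ∷ 0 ∷ 0 ∷ 0 ∷ 0 ∷ [])
  blockTail 8  = bits (1 ∷ 1 ∷ 1 ∷ 0 ∷ 0 ∷ 0 ∷ 1 ∷ 0 ∷ 0 ∷ 1 ∷ 0 ∷ 0 ∷ 1 ∷ 1 ∷ 0 ∷ 0 ∷ 0 ∷ 0 ∷ [])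
  blockTail 9  = bits (1 ∷ 1 ∷ 1 ∷ 0 ∷ 0 ∷ 0 ∷ 0 ∷ 0 ∷ 1 ∷ 1 ∷ 0 ∷ 0 ∷ 1 ∷ 1 ∷ 0 ∷ 0 ∷ 0 ∷ 0 ∷ 0 ∷ [])
  blockTail 10 = bits (1 ∷ 0 ∷ 1 ∷ 1 ∷ 0 ∷ 0 ∷ 0 ∷ 0 ∷ 0 ∷ 1 ∷ 1 ∷ 0 ∷ 0 ∷ 1 ∷ 1 ∷ 0 ∷ 0 ∷ 0 ∷ 0 ∷ 0 ∷ [])
  blockTail _  = []   -- unused: r < 11

  block : ℕ → List Bool
  block r = true ∷ blockTail r

  excess : ℕ → ℕ
  excess 2 = 1
  excess 5 = 1
  excess 8 = 1
  excess _ = 0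

  Special : ℕ → Set
  Special r = (r ≡ 2) ⊎ (r ≡ 5) ⊎ (r ≡ 8)

  excess-cases : ∀ r → (excess r ≡ 0) ⊎ (excess r ≡ 1 × Special r)
  excess-cases 2 = inj₂ (refl , inj₁ refl)
  excess-cases 5 = inj₂ (refl , inj₂ (inj₁ refl))
  excess-cases 8 = inj₂ (refl , inj₂ (inj₂ refl))
  excess-cases 0 = inj₁ refl
  excess-cases 1 = inj₁ refl
  excess-cases 3 = inj₁ refl
  excess-cases 4 = inj₁ refl
  excess-cases 6 = inj₁ refl
  excess-cases 7 = inj₁ refl
  excess-cases (suc (suc (suc (suc (suc (suc (suc (suc (suc r))))))))) = inj₁ refl

  -- What follows a word P^k B_r (k ≥ 1) cyclically: its first 12 letters P 1.
  seam : List Bool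
  seam = period ++ true ∷ []

  lengthOK weightOK seamOK aloneOK blockOK : ℕ → Bool
  lengthOK r = length (block r) ≡ᵇ 11 + r
  weightOK r = weight (block r) ≡ᵇ 4 + (4 * r + 10) / 11 + excess r
  seamOK   r = validWindows (length (period ++ block r)) ((period ++ block r) ++ seam)
  aloneOK  r = (r <ᵇ 2) ∨ cyclicallyValid (block r)
  blockOK  r = lengthOK r ∧ (weightOK r ∧ (seamOK r ∧ aloneOK r))

  blocks-checked : all blockOK (upTo 11) ≡ true
  blocks-checked = refl

  module _ (r : ℕ) (r<11 : r < 11) where
    private
      ok : T (blockOK r)
      ok = all-elim blockOK (Equivalence.from T-≡ blocks-checked) (∈-upTo⁺ r<11)

      ok₂ : T (weightOK r ∧ (seamOK r ∧ aloneOK r))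
      ok₂ = proj₂ (Equivalence.to (T-∧ {lengthOK r}) ok)

      ok₃ : T (seamOK r ∧ aloneOK r)
      ok₃ = proj₂ (Equivalence.to (T-∧ {weightOK r}) ok₂)

    block-length : length (block r) ≡ 11 + r
    block-length = ≡ᵇ⇒≡ _ _ (proj₁ (Equivalence.to (T-∧ {lengthOK r}) ok))

    block-weight : weight (block r) ≡ 4 + (4 * r + 10) / 11 + excess r
    block-weight = ≡ᵇ⇒≡ _ _ (proj₁ (Equivalence.to (T-∧ {weightOK r}) ok₂))

    block-seam : validWindows (length (period ++ block r)) ((period ++ block r) ++ seam) ≡ true
    block-seam = Equivalence.to T-≡ (proj₁ (Equivalence.to (T-∧ {seamOK r}) ok₃))

    block-alone : 2 ≤ r → cyclicallyValid (block r) ≡ true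
    block-alone 2≤r with Equivalence.to (T-∨ {r <ᵇ 2}) (proj₂ (Equivalence.to (T-∧ {seamOK r}) ok₃))
    ... | inj₁ r<2   = ⊥-elim (<⇒≱ (<ᵇ⇒< r 2 r<2) 2≤r)
    ... | inj₂ alone = Equivalence.to T-≡ alone

  repeat-valid : ∀ B → validWindows (length (period ++ true ∷ B)) ((period ++ true ∷ B) ++ seam) ≡ true →
                 ∀ j → validWindows (length (repeat (suc j) ++ true ∷ B)) ((repeat (suc j) ++ true ∷ B) ++ seam) ≡ true
  repeat-valid B base zero          = base
  repeat-valid B base (suc zero)    = repeat-valid B base zero
  repeat-valid B base (suc (suc j)) = repeat-valid B base (suc j)

  take-seam : ∀ B j → take 12 (repeat (suc j) ++ true ∷ B) ≡ seam
  take-seam B zero    = refl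
  take-seam B (suc j) = refl

  blockWord : ℕ → ℕ → List Bool
  blockWord r k = repeat k ++ block r

  blockWord-length : ∀ r k → r < 11 → length (blockWord r k) ≡ r + suc k * 11
  blockWord-length r k r<11 = begin
    length (repeat k ++ block r)        ≡⟨ length-++ (repeat k) ⟩
    length (repeat k) + length (block r) ≡⟨ cong₂ _+_ (length-repeat k) (block-length r r<11) ⟩
    k * 11 + (11 + r)                   ≡⟨ regroup k r ⟩
    r + suc k * 11                      ∎
    where
    open ≡-Reasoning
    length-repeat : ∀ k → length (repeat k) ≡ k * 11
    length-repeat zero    = refl
    length-repeat (suc k) = cong (11 +_) (length-repeat k)
    regroup : ∀ k r → k * 11 + (11 + r) ≡ r + suc k * 11
    regroup = solve-∀

  blockWord-weight : ∀ r k → r < 11 → weight (blockWord r k) ≡ 4 * k + (4 + (4 * r + 10) / 11 + excess r)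
  blockWord-weight r k r<11 = trans (weight-++ (repeat k) (block r)) (cong₂ _+_ (weight-repeat k) (block-weight r r<11))
    where
    weight-repeat : ∀ k → weight (repeat k) ≡ 4 * k
    weight-repeat zero    = refl
    weight-repeat (suc k) = trans (cong (4 +_) (weight-repeat k)) (sym (*-suc 4 k))

  blockWord-cyclic : ∀ r k → r < 11 → 13 ≤ r + suc k * 11 → cyclicallyValid (blockWord r k) ≡ true
  blockWord-cyclic r zero    r<11 13≤n = block-alone r r<11 (+-cancelʳ-≤ 11 2 r 13≤n)
  blockWord-cyclic r (suc j) r<11 _    =
    subst (λ t → validWindows (length w) (w ++ t) ≡ true) (sym (take-seam (blockTail r) j))
          (repeat-valid (blockTail r) (block-seam r r<11) j)
    where
    w = blockWord r (suc j)

  by-decision : ∀ {A : Set} (a? : Dec A) → isYes a? ≡ true → A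
  by-decision a? yes = toWitness {a? = a?} (Equivalence.from T-≡ yes)

  blockWord-identifying-≥13 : ∀ r k n .{{_ : NonZero n}} → r < 11 → n ≡ r + suc k * 11 → 13 ≤ r + suc k * 11 →
                              IsIdentifying n (wordCode n (blockWord r k))
  blockWord-identifying-≥13 r k n r<11 n≡ 13≤ =
    wordCode-identifying n (blockWord r k) (trans (blockWord-length r k r<11) (sym n≡))
      (subst (13 ≤_) (sym n≡) 13≤) (blockWord-cyclic r k r<11 13≤)

  -- For n = 11, 12 the two codes are checked by the decision procedure.
  blockWord-identifying : ∀ r k n .{{_ : NonZero n}} → r < 11 → n ≡ r + suc k * 11 →
                          IsIdentifying n (wordCode n (blockWord r k))
  blockWord-identifying 0             zero    .11 _    refl = by-decision (Decision.identifying? 11 (wordCode 11 (blockWord 0 0))) refl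
  blockWord-identifying 1             zero    .12 _    refl = by-decision (Decision.identifying? 12 (wordCode 12 (blockWord 1 0))) refl
  blockWord-identifying (suc (suc r)) zero    n   r<11 n≡   =
    blockWord-identifying-≥13 (suc (suc r)) 0 n r<11 n≡ (+-monoˡ-≤ 11 (s≤s (s≤s z≤n)))
  blockWord-identifying r             (suc k) n   r<11 n≡   =
    blockWord-identifying-≥13 r (suc k) n r<11 n≡ (≤-trans (m≤m+n 13 (9 + k * 11)) (m≤n+m _ r))


module Ceiling where
  open import Data.Nat
  open import Data.Nat.Properties
  open import Data.Nat.DivMod using (+-distrib-/-∣ʳ; m*n/n≡m; /-monoˡ-≤)
  open import Data.Nat.Divisibility using (n∣m*n)
  open import Data.Nat.Tactic.RingSolver using (solve-∀)
  open import Relation.Binary.PropositionalEquality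

  +-multiple-/11 : ∀ a k → (a + k * 11) / 11 ≡ a / 11 + k
  +-multiple-/11 a k = trans (+-distrib-/-∣ʳ a (n∣m*n k)) (cong (a / 11 +_) (m*n/n≡m k 11))

  ceil-≤ : ∀ n c → 4 * n ≤ 11 * c → ceil4n/11 n ≤ c
  ceil-≤ n c 4n≤11c = begin
    (4 * n + 10) / 11   ≤⟨ /-monoˡ-≤ 11 (+-monoˡ-≤ 10 4n≤11c) ⟩
    (11 * c + 10) / 11  ≡⟨ cong (_/ 11) (trans (+-comm (11 * c) 10) (cong (10 +_) (*-comm 11 c))) ⟩
    (10 + c * 11) / 11  ≡⟨ +-multiple-/11 10 c ⟩
    c                   ∎
    where open ≤-Reasoning

  ceil-block : ∀ r k → ceil4n/11 (r + suc k * 11) ≡ (4 * r + 10) / 11 + 4 * suc k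
  ceil-block r k = trans (cong (_/ 11) (regroup r k)) (+-multiple-/11 (4 * r + 10) (4 * suc k))
    where
    regroup : ∀ r k → 4 * (r + suc k * 11) + 10 ≡ 4 * r + 10 + 4 * suc k * 11
    regroup = solve-∀


module Optimum (n : ℕ) .{{_ : NonZero n}} (11≤n : 11 ≤ n) where
  open import Data.Nat
  open import Data.Nat.Properties
  open import Data.Nat.DivMod using (m%n<n; m≡m%n+[m/n]*n)
  open import Data.Nat.Tactic.RingSolver using (solve-∀)
  open import Data.Fin.Subset.Properties using (anySubset?)
  open import Data.Product using (_,_)
  open import Data.Empty using (⊥-elim)
  open import Relation.Nullary using (Dec)
  open import Relation.Nullary.Decidable using (_×-dec_)
  open import Relation.Binary.PropositionalEquality
  open Words
  open Construction
  open Ceiling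

  L : ℕ
  L = ceil4n/11 n

  at-least-L : ∀ C → IsIdentifying n C → L ≤ ∣ C ∣
  at-least-L C identifying = ceil-≤ n ∣ C ∣ (LowerBound.lower-bound n C identifying 11≤n)

  -- Writing n = r + (k + 1)·11, the code P^k B_r.
  construction : Σ (Subset n) λ C → IsIdentifying n C × ∣ C ∣ ≡ L + excess (n % 11)
  construction = build (n / 11) (m≡m%n+[m/n]*n n 11)
    where
    r = n % 11
    r<11 = m%n<n n 11
    build : ∀ q → n ≡ r + q * 11 → Σ (Subset n) λ C → IsIdentifying n C × ∣ C ∣ ≡ L + excess r
    build zero    n≡ = ⊥-elim (<⇒≱ r<11 (subst (11 ≤_) (trans n≡ (+-identityʳ r)) 11≤n))
    build (suc k) n≡ = wordCode n (blockWord r k) , blockWord-identifying r k n r<11 n≡ , (begin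
      ∣ wordCode n (blockWord r k) ∣                ≡⟨ wordCode-size n (blockWord r k) (trans (blockWord-length r k r<11) (sym n≡)) ⟩
      weight (blockWord r k)                        ≡⟨ blockWord-weight r k r<11 ⟩
      4 * k + (4 + (4 * r + 10) / 11 + excess r)    ≡⟨ regroup k ((4 * r + 10) / 11) (excess r) ⟩
      (4 * r + 10) / 11 + 4 * suc k + excess r      ≡⟨ cong (_+ excess r) (sym (trans (cong ceil4n/11 n≡) (ceil-block r k))) ⟩
      L + excess r                                  ∎)
      where
      open ≡-Reasoning
      regroup : ∀ k c e → 4 * k + (4 + c + e) ≡ c + 4 * suc k + e
      regroup = solve-∀

  ExactCode : Set
  ExactCode = Σ (Subset n) λ C → IsIdentifying n C × ∣ C ∣ ≡ L

  exact? : Dec ExactCode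
  exact? = anySubset? (λ C → Decision.identifying? n C ×-dec (∣ C ∣ ≟ L))

  above-L : ¬ ExactCode → ∀ C → IsIdentifying n C → L + 1 ≤ ∣ C ∣
  above-L none C identifying =
    subst (_≤ ∣ C ∣) (+-comm 1 L) (≤∧≢⇒< (at-least-L C identifying) (λ L≡ → none (C , identifying , sym L≡)))


theorem1 : (n : ℕ) → .{{_ : NonZero n}} → 11 ≤ n →
    Σ ℕ (λ g → IsGammaID n g ×
      (((n % 11 ≡ 2) ⊎ (n % 11 ≡ 5) ⊎ (n % 11 ≡ 8)) →
          (ceil4n/11 n ≤ g) × (g ≤ ceil4n/11 n + 1))
      × (¬ ((n % 11 ≡ 2) ⊎ (n % 11 ≡ 5) ⊎ (n % 11 ≡ 8)) →
          g ≡ ceil4n/11 n))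
theorem1 n 11≤n = classify exact? construction (Construction.excess-cases (n % 11))
  where
  open import Data.Nat.Properties using (≤-refl; m≤m+n; +-identityʳ)
  open import Data.Empty using (⊥-elim)
  open import Relation.Nullary using (Dec; yes; no)
  open import Relation.Binary.PropositionalEquality using (trans; cong)
  open Construction using (excess; Special)
  open Optimum n 11≤n
  r = n % 11
  -- If a code of size L exists it is optimal by the lower bound; otherwise the
  -- constructed code, of size L + excess r, must have excess r = 1, and is optimal.
  classify : Dec ExactCode → (Σ (Subset n) λ C → IsIdentifying n C × ∣ C ∣ ≡ L + excess r) →
             (excess r ≡ 0) ⊎ (excess r ≡ 1 × Special r) →
             Σ ℕ λ g → IsGammaID n g × (Special r → L ≤ g × g ≤ L + 1) × (¬ Special r → g ≡ L)
  classify (yes exact) _ _ = L , (exact , at-least-L) , (λ _ → ≤-refl , m≤m+n L 1) , (λ _ → refl)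
  classify (no none) (C , identifying , size) (inj₁ excess≡0) =
    ⊥-elim (none (C , identifying , trans size (trans (cong (L +_) excess≡0) (+-identityʳ L))))
  classify (no none) (C , identifying , size) (inj₂ (excess≡1 , special)) =
    L + 1 , ((C , identifying , trans size (cong (L +_) excess≡1)) , above-L none) ,
    (λ _ → m≤m+n L 1 , ≤-refl) , (λ ¬special → ⊥-elim (¬special special))
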